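{- The tiling problem $P$ has a solution iff $\mathcal{T}_P$ is consistent.
   Context: A tiling problem $P=(T,H,V)$ consists of a finite set $T$ of tile types and relations $H,V\subseteq T\times T$; a solution is $\pi:\mathbb{N}\times\mathbb{N}\to T$ with $(\pi(i,j),\pi(i+1,j))\in H$ and $(\pi(i,j),\pi(i,j+1))\in V$ for all $i,j$. $\mathcal{SSCC}$ extends $\mathcal{ALCSCC}$ ($\mathcal{ALC}$ with $\mathsf{succ}$-restrictions, i.e.\ QFBAPA constraints over role successors, evaluated over finitely branching interpretations, where $\mathcal{U}$ ranges over all role successors of an element) with transitivity axioms $\mathsf{trans}(r)$; $r\sqsubseteq s$ abbreviates $\top\sqsubseteq\mathsf{succ}(r\subseteq s)$. The TBox $\mathcal{T}_P$, using concept names $A_t$ ($t\in T$), $A_{ij}$, role names $h,v,h_i,v_j,r_{ij}$ ($i,j\in\{0,1\}$), consists of: $\top\sqsubseteq \bigsqcup_{t\in T}A_t \sqcap C$, where $C$ is the conjunction (via $\sqcap$) of all concepts $\neg(A_t\sqcap A_{t'})$ with $t\neq t'\in T$; $\top\sqsubseteq\mathsf{succ}(|h|=1\wedge|v|=1)$; for each $t\in T$: $A_t\sqsubseteq\mathsf{succ}(h\subseteq\bigsqcup_{(t,t')\in H}A_{t'})$ and $A_t\sqsubseteq\mathsf{succ}(v\subseteq\bigsqcup_{(t,t')\in V}A_{t'})$; for $i,j\in\{0,1\}$: $\mathsf{trans}(r_{ij})$, $h_i\sqsubseteq r_{ij}$, $v_j\sqsubseteq r_{ij}$; a CI stating that every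 element belongs to exactly one of $A_{00},A_{01},A_{10},A_{11}$ (a disjunction of the four and, conjoined via $\sqcap$, all $\neg(A_{ij}\sqcap A_{i'j'})$ for distinct pairs); for $i,j\in\{0,1\}$: $A_{ij}\sqsubseteq\mathsf{succ}(h\subseteq A_{(1-i)j}\wedge v\subseteq A_{i(1-j)})$ and $A_{ij}\sqsubseteq\mathsf{succ}(h=h_i\wedge v=v_j)$; and $\top\sqsubseteq\mathsf{succ}(|h^c\cap v^c|=1)$. -}

module Defs where

open import Level using (0ℓ)
open import Data.Bool using (Bool; true; false; not; if_then_else_; _∧_; _∨_)
open import Data.Bool.Properties using () renaming (_≟_ to _≟ᵇ_)
open import Data.Nat using (ℕ; suc; _+_; _*_; _≤ᵇ_; _≡ᵇ_)
open import Data.Nat.Divisibility using (_∣?_)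
open import Data.Fin using (Fin) renaming (_≟_ to _≟ᶠ_)
open import Data.List using (_++_; List; []; _∷_; [_]; foldr; map; concatMap; allFin)
open import Data.List.Membership.Propositional using (_∈_)
open import Data.List.Relation.Unary.All using (All)
open import Data.List.Relation.Unary.Unique.Propositional using (Unique)
open import Data.Product using (Σ; ∃; _×_; _,_)
open import Data.Product.Properties using (≡-dec)
open import Relation.Binary using (Rel; Decidable; DecidableEquality)
open import Relation.Binary.PropositionalEquality using (_≡_)
open import Relation.Nullary using (does)

-- Concepts are ALC concepts plus succ-restrictions succ(c), where c is a
-- QFBAPA constraint over set terms built from role names, concepts,
-- ∅, 𝒰 (all role successors), complement, ∩, ∪.

module Syntax (NC NR : Set) where

  data Concept : Set
  data SetTerm : Set
  data LinExp : Set
  data Constraint : Set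

  data Concept where
    ⊤ᶜ ⊥ᶜ : Concept
    name  : NC → Concept
    ¬ᶜ_   : Concept → Concept
    _⊓_ _⊔_ : Concept → Concept → Concept
    succ  : Constraint → Concept

  data SetTerm where
    ∅ 𝒰   : SetTerm
    role  : NR → SetTerm
    conc  : Concept → SetTerm
    _ᶜ    : SetTerm → SetTerm
    _∩_ _∪_ : SetTerm → SetTerm → SetTerm

  data LinExp where
    const : ℕ → LinExp
    card  : SetTerm → LinExp
    _⊕_   : LinExp → LinExp → LinExp
    _⊛_   : ℕ → LinExp → LinExp

  data Constraint where
    _⊆ₛ_ _≐_ : SetTerm → SetTerm → Constraint
    _≤ₗ_ _=ₗ_ : LinExp → LinExp → Constraint
    _dvd_ : ℕ → LinExp → Constraint
    _∧ₖ_ _∨ₖ_ : Constraint → Constraint → Constraint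
    ¬ₖ_ : Constraint → Constraint

  data Axiom : Set where
    _⊑_   : Concept → Concept → Axiom
    trans : NR → Axiom

  TBox : Set
  TBox = List Axiom

  ⨆ : List Concept → Concept
  ⨆ = foldr _⊔_ ⊥ᶜ

  ⨅ : List Concept → Concept
  ⨅ = foldr _⊓_ ⊤ᶜ

  roleIncl : NR → NR → Axiom
  roleIncl r s = ⊤ᶜ ⊑ succ (role r ⊆ₛ role s)

  pairwiseDisjoint : {A : Set} → DecidableEquality A → (A → Concept) → List A → Concept
  pairwiseDisjoint _≟_ f xs =
    ⨅ (concatMap (λ a → concatMap (λ b →
         if does (a ≟ b) then [] else [ ¬ᶜ (f a ⊓ f b) ]) xs) xs)

-- Finitely branching interpretations (truth values as Bool).
-- succs d lists, without repetition, exactly the role successors of d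
-- (over all role names); this is the finite set 𝒰 at d.

record Interpretation (NC NR : Set) : Set₁ where
  field
    Δ        : Set
    point    : Δ
    conceptI : NC → Δ → Bool
    roleI    : NR → Δ → Δ → Bool
    succs    : Δ → List Δ
    succs-unique   : ∀ d → Unique (succs d)
    succs-sound    : ∀ d e → e ∈ succs d → ∃ λ r → roleI r d e ≡ true
    succs-complete : ∀ d e r → roleI r d e ≡ true → e ∈ succs d

count : {A : Set} → (A → Bool) → List A → ℕ
count p [] = 0
count p (x ∷ xs) = if p x then suc (count p xs) else count p xs

allB : {A : Set} → (A → Bool) → List A → Bool
allB p [] = true
allB p (x ∷ xs) = p x ∧ allB p xs

module Semantics {NC NR : Set} (I : Interpretation NC NR) where
  open Interpretation I
  open Syntax NC NR

  evalC : Concept → Δ → Bool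
  evalS : SetTerm → Δ → Δ → Bool      -- evalS s d e : is the successor e of d in s^I(d)?
  evalL : LinExp → Δ → ℕ
  evalK : Constraint → Δ → Bool

  evalC ⊤ᶜ d = true
  evalC ⊥ᶜ d = false
  evalC (name A) d = conceptI A d
  evalC (¬ᶜ C) d = not (evalC C d)
  evalC (C ⊓ D) d = evalC C d ∧ evalC D d
  evalC (C ⊔ D) d = evalC C d ∨ evalC D d
  evalC (succ c) d = evalK c d

  -- only ever applied to e ∈ succs d, so 𝒰 and complement are relative to 𝒰
  evalS ∅ d e = false
  evalS 𝒰 d e = true
  evalS (role r) d e = roleI r d e
  evalS (conc C) d e = evalC C e
  evalS (s ᶜ) d e = not (evalS s d e)
  evalS (s ∩ t) d e = evalS s d e ∧ evalS t d e
  evalS (s ∪ t) d e = evalS s d e ∨ evalS t d e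

  evalL (const k) d = k
  evalL (card s) d = count (λ e → evalS s d e) (succs d)
  evalL (l ⊕ m) d = evalL l d + evalL m d
  evalL (k ⊛ l) d = k * evalL l d

  evalK (s ⊆ₛ t) d = allB (λ e → not (evalS s d e) ∨ evalS t d e) (succs d)
  evalK (s ≐ t) d = allB (λ e → not (evalS s d e) ∨ evalS t d e) (succs d)
                  ∧ allB (λ e → not (evalS t d e) ∨ evalS s d e) (succs d)
  evalK (l ≤ₗ m) d = evalL l d ≤ᵇ evalL m d
  evalK (l =ₗ m) d = evalL l d ≡ᵇ evalL m d
  evalK (k dvd l) d = does (k ∣? evalL l d)
  evalK (c ∧ₖ c') d = evalK c d ∧ evalK c' d
  evalK (c ∨ₖ c') d = evalK c d ∨ evalK c' d
  evalK (¬ₖ c) d = not (evalK c d)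

  satisfies : Axiom → Set
  satisfies (C ⊑ D) = ∀ d → evalC C d ≡ true → evalC D d ≡ true
  satisfies (trans r) = ∀ d e f → roleI r d e ≡ true → roleI r e f ≡ true → roleI r d f ≡ true

  IsModel : TBox → Set
  IsModel 𝒯 = All satisfies 𝒯

Consistent : {NC NR : Set} → Syntax.TBox NC NR → Set₁
Consistent {NC} {NR} 𝒯 = Σ (Interpretation NC NR) λ I → Semantics.IsModel I 𝒯

HasSolution : (n : ℕ) → Rel (Fin n) 0ℓ → Rel (Fin n) 0ℓ → Set
HasSolution n H V =
  Σ (ℕ → ℕ → Fin n) λ π →
    ∀ i j → H (π i j) (π (suc i) j) × V (π i j) (π i (suc j))

-- The TBox 𝒯_P.  Besides the names used by 𝒯_P, the signature contains
-- countably many further concept and role names.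

data CName (n : ℕ) : Set where
  A      : Fin n → CName n
  Aq     : Bool → Bool → CName n
  extraC : ℕ → CName n

data RName : Set where
  h v    : RName
  hᵢ vⱼ  : Bool → RName
  r      : Bool → Bool → RName
  extraR : ℕ → RName

module _ (n : ℕ) (H V : Rel (Fin n) 0ℓ) (H? : Decidable H) (V? : Decidable V) where
  open Syntax (CName n) RName

  private
    tiles : List (Fin n)
    tiles = allFin n

    bools : List Bool
    bools = false ∷ true ∷ []

    quads : List (Bool × Bool)
    quads = concatMap (λ i → map (λ j → (i , j)) bools) bools

    Aᶜ : Fin n → Concept
    Aᶜ t = name (A t)

    Aqᶜ : Bool × Bool → Concept
    Aqᶜ (i , j) = name (Aq i j)

    hSucc vSucc : Fin n → Concept
    hSucc t = ⨆ (concatMap (λ t' → if does (H? t t') then [ Aᶜ t' ] else []) tiles)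
    vSucc t = ⨆ (concatMap (λ t' → if does (V? t t') then [ Aᶜ t' ] else []) tiles)

    tileAxioms : Fin n → List Axiom
    tileAxioms t =
      (Aᶜ t ⊑ succ (role h ⊆ₛ conc (hSucc t))) ∷
      (Aᶜ t ⊑ succ (role v ⊆ₛ conc (vSucc t))) ∷ []

    quadAxioms : Bool × Bool → List Axiom
    quadAxioms (i , j) =
      trans (r i j) ∷
      roleIncl (hᵢ i) (r i j) ∷
      roleIncl (vⱼ j) (r i j) ∷
      (Aqᶜ (i , j) ⊑ succ ((role h ⊆ₛ conc (Aqᶜ (not i , j))) ∧ₖ (role v ⊆ₛ conc (Aqᶜ (i , not j))))) ∷
      (Aqᶜ (i , j) ⊑ succ ((role h ≐ role (hᵢ i)) ∧ₖ (role v ≐ role (vⱼ j)))) ∷ []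

  𝒯P : TBox
  𝒯P =
    (⊤ᶜ ⊑ (⨆ (map Aᶜ tiles) ⊓ pairwiseDisjoint _≟ᶠ_ Aᶜ tiles)) ∷
    (⊤ᶜ ⊑ succ ((card (role h) =ₗ const 1) ∧ₖ (card (role v) =ₗ const 1))) ∷
    (⊤ᶜ ⊑ (⨆ (map Aqᶜ quads) ⊓ pairwiseDisjoint (≡-dec _≟ᵇ_ _≟ᵇ_) Aqᶜ quads)) ∷
    (⊤ᶜ ⊑ succ (card ((role h ᶜ) ∩ (role v ᶜ)) =ₗ const 1)) ∷
    (concatMap tileAxioms tiles ++ concatMap quadAxioms quads)

-- A model of 𝒯_P yields a tiling: every element has a unique h-successor
-- ("east") and v-successor ("north"), and these commute.  Indeed, if d lies
-- in quadrant (i , j), then h = hᵢ and v = vⱼ along both paths d → east → north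
-- and d → north → east, so by transitivity of r_ij both endpoints are
-- r_ij-successors of d; their quadrant (¬i , ¬j) differs from those of
-- east d and north d, so both are the unique successor of d that is
-- neither an h- nor a v-successor.  Iterating east and north from any element
-- thus gives a grid, and the tiles along it solve P.  Conversely, a tiling
-- is turned into a model on ℕ × ℕ whose successors of (x , y) are
-- (x+1 , y), (x , y+1) and (x+1 , y+1), with quadrants given by parities.
module Submission where

open import Level using (0ℓ)
open import Data.Bool using (Bool; true; false; not; _∧_; _∨_; if_then_else_)
open import Data.Bool.Properties using (∧-conicalˡ; ∧-conicalʳ; ∨-zeroʳ; ∨-inverseˡ; not-¬; ¬-not; T-≡)
  renaming (_≟_ to _≟ᵇ_)
open import Data.Nat using (ℕ; zero; suc)
open import Data.Nat.Properties using (≡ᵇ⇒≡; suc-injective; 1+n≢n) renaming (_≟_ to _≟ℕ_)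
open import Data.Fin using (Fin) renaming (_≟_ to _≟ᶠ_)
open import Data.List using (List; []; _∷_; [_]; map; concatMap; allFin)
open import Data.List.Membership.Propositional using (_∈_; find; lose)
open import Data.List.Membership.Propositional.Properties using (∈-allFin)
open import Data.List.Relation.Unary.Any using (Any; here; there)
import Data.List.Relation.Unary.Any.Properties as Any
open import Data.List.Relation.Unary.All as All using (All; []; _∷_)
import Data.List.Relation.Unary.All.Properties as All
open import Data.List.Relation.Unary.AllPairs using ([]; _∷_)
open import Data.Maybe using (Maybe; just; nothing; maybe)
open import Data.Empty using (⊥; ⊥-elim)
open import Data.Product using (∃; ∃!; _×_; _,_; proj₁; proj₂)
open import Data.Product.Properties using (≡-dec)
open import Function.Bundles using (_⇔_; mk⇔; Equivalence)
open import Relation.Binary using (Rel; Decidable; DecidableEquality)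
open import Relation.Binary.PropositionalEquality as ≡
  using (_≡_; refl; sym; cong; cong₂; subst; module ≡-Reasoning)
open import Relation.Nullary using (Dec; yes; no; does; contradiction)
open import Relation.Nullary.Decidable using (dec-true)

open import Defs

does-true⇒ : ∀ {A : Set} (a? : Dec A) → does a? ≡ true → A
does-true⇒ (yes a) _ = a

⇒-true : ∀ {x y} → not x ∨ y ≡ true → x ≡ true → y ≡ true
⇒-true p refl = p

not-∧≡true⁺ : ∀ {x y} → (x ≡ true → y ≡ true → ⊥) → not (x ∧ y) ≡ true
not-∧≡true⁺ {true}  {true}  ¬both = ⊥-elim (¬both refl refl)
not-∧≡true⁺ {true}  {false} _     = refl
not-∧≡true⁺ {false}         _     = refl

not-∧≡true⁻ : ∀ {x y} → not (x ∧ y) ≡ true → x ≡ true → y ≡ true → ⊥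
not-∧≡true⁻ () refl refl

All-concatMap⁺ : ∀ {A B : Set} {P : B → Set} {f : A → List B} →
                 (∀ x → All P (f x)) → ∀ xs → All P (concatMap f xs)
All-concatMap⁺ Pf xs = All.concat⁺ (All.map⁺ (All.universal Pf xs))

All-concatMap⁻ : ∀ {A B : Set} {P : B → Set} (f : A → List B) {xs x} →
                 All P (concatMap f xs) → x ∈ xs → All P (f x)
All-concatMap⁻ _ all = All.lookup (All.map⁻ (All.concat⁻ all))

allB-lookup : ∀ {A : Set} (p : A → Bool) {xs x} → allB p xs ≡ true → x ∈ xs → p x ≡ true
allB-lookup p {y ∷ _} all (here refl) = ∧-conicalˡ (p y) _ all
allB-lookup p {y ∷ _} all (there x∈) = allB-lookup p (∧-conicalʳ (p y) _ all) x∈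

count≡0⇒false : ∀ {A : Set} (p : A → Bool) {xs x} → count p xs ≡ 0 → x ∈ xs → p x ≡ false
count≡0⇒false p {y ∷ _} c x∈ with p y in py
count≡0⇒false p {y ∷ _} () _           | true
count≡0⇒false p {y ∷ _} c (here refl) | false = py
count≡0⇒false p {y ∷ _} c (there x∈)  | false = count≡0⇒false p c x∈

count≡1⇒∃! : ∀ {A : Set} (p : A → Bool) xs → count p xs ≡ 1 → ∃! _≡_ (λ x → x ∈ xs × p x ≡ true)
count≡1⇒∃! p (y ∷ ys) c with p y in py
... | true = y , (here refl , py) , only-y
  where
  only-y : ∀ {x} → x ∈ y ∷ ys × p x ≡ true → y ≡ x
  only-y (here refl , _)  = refl
  only-y (there x∈ , px) = contradiction (≡.trans (sym (count≡0⇒false p (suc-injective c) x∈)) px) λ ()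
... | false with count≡1⇒∃! p ys c
...   | x , (x∈ , px) , only-x = x , (there x∈ , px) , only
  where
  only : ∀ {z} → z ∈ y ∷ ys × p z ≡ true → x ≡ z
  only (here refl , pz) = contradiction (≡.trans (sym py) pz) λ ()
  only (there z∈ , pz) = only-x (z∈ , pz)

∃!-∈⁻ : ∀ {A : Set} {P : A → Set} {xs} → (∀ x → x ∈ xs) → ∃! _≡_ (λ x → x ∈ xs × P x) → ∃! _≡_ P
∃!-∈⁻ complete (x , (_ , px) , only) = x , px , λ py → only (complete _ , py)

module UniqueChoice {D X : Set} (P : D → X → Set) (unique : ∀ d → ∃! _≡_ (P d)) where

  choice : D → X
  choice d = proj₁ (unique d)

  choice-holds : ∀ d → P d (choice d)
  choice-holds d = proj₁ (proj₂ (unique d))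

  choice-unique : ∀ {d x} → P d x → x ≡ choice d
  choice-unique {d} Pdx = sym (proj₂ (proj₂ (unique d)) Pdx)

module DerivedConcepts (NC NR : Set) where
  open Syntax NC NR

  exactlyOne : {X : Set} → DecidableEquality X → (X → Concept) → List X → Concept
  exactlyOne _≟_ f xs = ⨆ (map f xs) ⊓ pairwiseDisjoint _≟_ f xs

  ⨆-image : {X : Set} {R : Rel X 0ℓ} → Decidable R → (X → Concept) → List X → X → Concept
  ⨆-image R? f ys x = ⨆ (concatMap (λ y → if does (R? x y) then [ f y ] else []) ys)

module Satisfaction {NC NR : Set} (I : Interpretation NC NR) where
  open Interpretation I
  open Syntax NC NR
  open Semantics I
  open DerivedConcepts NC NR

  infix 4 _⊨_
  _⊨_ : Δ → Concept → Set
  d ⊨ C = evalC C d ≡ true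

  module _ {d : Δ} where

    ⊨-⨆⁺ : ∀ cs → Any (d ⊨_) cs → d ⊨ ⨆ cs
    ⊨-⨆⁺ (c ∷ cs) (here d⊨c) rewrite d⊨c = refl
    ⊨-⨆⁺ (c ∷ cs) (there d⊨cs) rewrite ⊨-⨆⁺ cs d⊨cs = ∨-zeroʳ (evalC c d)

    ⊨-⨆⁻ : ∀ cs → d ⊨ ⨆ cs → Any (d ⊨_) cs
    ⊨-⨆⁻ (c ∷ cs) d⊨ with evalC c d in d⊨c
    ... | true  = here d⊨c
    ... | false = there (⊨-⨆⁻ cs d⊨)

    ⊨-⨅⁺ : ∀ {cs} → All (d ⊨_) cs → d ⊨ ⨅ cs
    ⊨-⨅⁺ []             = refl
    ⊨-⨅⁺ (d⊨c ∷ d⊨cs) rewrite d⊨c = ⊨-⨅⁺ d⊨cs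

    ⊨-⨅⁻ : ∀ cs → d ⊨ ⨅ cs → All (d ⊨_) cs
    ⊨-⨅⁻ []       _  = []
    ⊨-⨅⁻ (c ∷ cs) d⊨ = ∧-conicalˡ (evalC c d) _ d⊨ ∷ ⊨-⨅⁻ cs (∧-conicalʳ (evalC c d) _ d⊨)

    module _ {X : Set} (_≟_ : DecidableEquality X) (f : X → Concept) where

      private
        disjointness : X → X → List Concept
        disjointness x y = if does (x ≟ y) then [] else [ ¬ᶜ (f x ⊓ f y) ]

      ⊨-pairwiseDisjoint⁺ : ∀ xs → (∀ {x y} → d ⊨ f x → d ⊨ f y → x ≡ y) →
                             d ⊨ pairwiseDisjoint _≟_ f xs
      ⊨-pairwiseDisjoint⁺ xs atMostOne =
        ⊨-⨅⁺ (All-concatMap⁺ (λ x → All-concatMap⁺ (disjoint x) xs) xs)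
        where
        disjoint : ∀ x y → All (d ⊨_) (disjointness x y)
        disjoint x y with x ≟ y
        ... | yes _ = []
        ... | no x≢y = not-∧≡true⁺ (λ fx fy → x≢y (atMostOne fx fy)) ∷ []

      ⊨-pairwiseDisjoint⁻ : ∀ xs → d ⊨ pairwiseDisjoint _≟_ f xs →
                             ∀ {x y} → x ∈ xs → y ∈ xs → d ⊨ f x → d ⊨ f y → x ≡ y
      ⊨-pairwiseDisjoint⁻ xs d⊨ x∈ y∈ =
        let row = All-concatMap⁻ (λ x → concatMap (disjointness x) xs) (⊨-⨅⁻ _ d⊨) x∈
        in disjoint⇒≡ (All-concatMap⁻ (disjointness _) row y∈)
        where
        disjoint⇒≡ : ∀ {x y} → All (d ⊨_) (disjointness x y) → d ⊨ f x → d ⊨ f y → x ≡ y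
        disjoint⇒≡ {x} {y} d⊨x≠y fx fy with x ≟ y
        ... | yes x≡y = x≡y
        ... | no _    = ⊥-elim (not-∧≡true⁻ (All.head d⊨x≠y) fx fy)

      ⊨-exactlyOne⁺ : ∀ xs {x} → x ∈ xs → d ⊨ f x → (∀ {y} → d ⊨ f y → y ≡ x) →
                      d ⊨ exactlyOne _≟_ f xs
      ⊨-exactlyOne⁺ xs x∈ fx only =
        cong₂ _∧_ (⊨-⨆⁺ (map f xs) (Any.map⁺ (lose x∈ fx)))
                  (⊨-pairwiseDisjoint⁺ xs λ fy fz → ≡.trans (only fy) (sym (only fz)))

      ⊨-exactlyOne⁻ : ∀ xs → d ⊨ exactlyOne _≟_ f xs → ∃! _≡_ (λ x → x ∈ xs × d ⊨ f x)
      ⊨-exactlyOne⁻ xs d⊨ =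
        let x , x∈ , fx = find (Any.map⁻ (⊨-⨆⁻ (map f xs) (∧-conicalˡ _ _ d⊨)))
            disjoint = ∧-conicalʳ (evalC (⨆ (map f xs)) d) _ d⊨
        in x , (x∈ , fx) , λ (y∈ , fy) → ⊨-pairwiseDisjoint⁻ xs disjoint x∈ y∈ fx fy

    module _ {X : Set} {R : Rel X 0ℓ} (R? : Decidable R) (f : X → Concept) where

      private
        ifRelated : X → X → List Concept
        ifRelated x y = if does (R? x y) then [ f y ] else []

      ⊨-⨆-image⁺ : ∀ ys {x y} → y ∈ ys → R x y → d ⊨ f y → d ⊨ ⨆-image R? f ys x
      ⊨-⨆-image⁺ ys {x} {y} y∈ Rxy fy =
        ⊨-⨆⁺ (concatMap (ifRelated x) ys) (Any.concatMap⁺ (ifRelated x) (lose y∈ chosen))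
        where
        chosen : Any (d ⊨_) (ifRelated x y)
        chosen with R? x y
        ... | yes _   = here fy
        ... | no ¬Rxy = contradiction Rxy ¬Rxy

      ⊨-⨆-image⁻ : ∀ ys {x} → d ⊨ ⨆-image R? f ys x → ∃ λ y → R x y × d ⊨ f y
      ⊨-⨆-image⁻ ys {x} d⊨ =
        let anyRelated = Any.concatMap⁻ (ifRelated x) {xs = ys} (⊨-⨆⁻ (concatMap (ifRelated x) ys) d⊨)
        in chosen (proj₂ (proj₂ (find anyRelated)))
        where
        chosen : ∀ {y} → Any (d ⊨_) (ifRelated x y) → ∃ λ y → R x y × d ⊨ f y
        chosen {y} d⊨y with R? x y
        chosen (here fy) | yes Rxy = _ , Rxy , fy

  ⊨-⊆-role-successor : ∀ {ρ} t {d e} → evalK (role ρ ⊆ₛ t) d ≡ true → roleI ρ d e ≡ true →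
                       evalS t d e ≡ true
  ⊨-⊆-role-successor {ρ} _ {d} {e} incl ρde = ⇒-true (allB-lookup _ incl (succs-complete d e ρ ρde)) ρde

  ⊨-⊆-role : ∀ {ρ σ d e} → evalK (role ρ ⊆ₛ role σ) d ≡ true → roleI ρ d e ≡ true → roleI σ d e ≡ true
  ⊨-⊆-role {σ = σ} = ⊨-⊆-role-successor (role σ)

  ⊨-≐-role : ∀ {ρ σ d e} → evalK (role ρ ≐ role σ) d ≡ true → roleI ρ d e ≡ true → roleI σ d e ≡ true
  ⊨-≐-role {ρ} {σ} {d} both = ⊨-⊆-role (∧-conicalˡ _ (evalK (role σ ⊆ₛ role ρ) d) both)

  ⊨-⊆-conc : ∀ {ρ d e} C → evalK (role ρ ⊆ₛ conc C) d ≡ true → roleI ρ d e ≡ true → e ⊨ C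
  ⊨-⊆-conc C = ⊨-⊆-role-successor (conc C)

  ⊨-∧ₖ⁻ : ∀ c c' {d} → evalK (c ∧ₖ c') d ≡ true → evalK c d ≡ true × evalK c' d ≡ true
  ⊨-∧ₖ⁻ c _ {d} both = ∧-conicalˡ _ _ both , ∧-conicalʳ (evalK c d) _ both

  ⊨-card≡1⇒∃! : ∀ {s d} → evalK (card s =ₗ const 1) d ≡ true →
                 ∃! _≡_ (λ e → e ∈ succs d × evalS s d e ≡ true)
  ⊨-card≡1⇒∃! {s} {d} c = count≡1⇒∃! (evalS s d) (succs d) (≡ᵇ⇒≡ _ 1 (Equivalence.from T-≡ c))

  ⊨-card-role≡1⇒∃! : ∀ {ρ d} → evalK (card (role ρ) =ₗ const 1) d ≡ true →
                      ∃! _≡_ (λ e → roleI ρ d e ≡ true)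
  ⊨-card-role≡1⇒∃! {ρ} {d} c =
    let e , (_ , ρde) , only = ⊨-card≡1⇒∃! {s = role ρ} c
    in e , ρde , λ {e'} ρde' → only (succs-complete d e' ρ ρde' , ρde')

-- The private building blocks of 𝒯P, restated so that they unfold to the same terms.
module TilingTBox {n : ℕ} {H V : Rel (Fin n) 0ℓ} (H? : Decidable H) (V? : Decidable V) where
  open Syntax (CName n) RName
  open DerivedConcepts (CName n) RName

  Aᶜ : Fin n → Concept
  Aᶜ t = name (A t)

  Aqᶜ : Bool × Bool → Concept
  Aqᶜ (i , j) = name (Aq i j)

  quadrants : List (Bool × Bool)
  quadrants = (false , false) ∷ (false , true) ∷ (true , false) ∷ (true , true) ∷ []

  ∈-quadrants : ∀ q → q ∈ quadrants
  ∈-quadrants (false , false) = here refl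
  ∈-quadrants (false , true)  = there (here refl)
  ∈-quadrants (true  , false) = there (there (here refl))
  ∈-quadrants (true  , true)  = there (there (there (here refl)))

  tileAxioms : Fin n → List Axiom
  tileAxioms t =
    (Aᶜ t ⊑ succ (role h ⊆ₛ conc (⨆-image H? Aᶜ (allFin n) t))) ∷
    (Aᶜ t ⊑ succ (role v ⊆ₛ conc (⨆-image V? Aᶜ (allFin n) t))) ∷ []

  quadAxioms : Bool × Bool → List Axiom
  quadAxioms (i , j) =
    trans (r i j) ∷
    roleIncl (hᵢ i) (r i j) ∷
    roleIncl (vⱼ j) (r i j) ∷
    (Aqᶜ (i , j) ⊑ succ ((role h ⊆ₛ conc (Aqᶜ (not i , j))) ∧ₖ (role v ⊆ₛ conc (Aqᶜ (i , not j))))) ∷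
    (Aqᶜ (i , j) ⊑ succ ((role h ≐ role (hᵢ i)) ∧ₖ (role v ≐ role (vⱼ j)))) ∷ []

module TilingFromModel {n : ℕ} {H V : Rel (Fin n) 0ℓ} (H? : Decidable H) (V? : Decidable V)
                       (I : Interpretation (CName n) RName)
                       (model : Semantics.IsModel I (𝒯P n H V H? V?)) where
  open Interpretation I
  open Syntax (CName n) RName
  open Semantics I
  open DerivedConcepts (CName n) RName
  open Satisfaction I
  open TilingTBox H? V?

  exactlyOneTile : ∀ d → d ⊨ exactlyOne _≟ᶠ_ Aᶜ (allFin n)
  exactlyOneTile d = All.head model d refl

  h-v-functional : ∀ d → evalK (card (role h) =ₗ const 1) d ≡ true × evalK (card (role v) =ₗ const 1) d ≡ true
  h-v-functional d =
    ⊨-∧ₖ⁻ (card (role h) =ₗ const 1) (card (role v) =ₗ const 1) (All.head (All.drop⁺ 1 model) d refl)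

  exactlyOneQuadrant : ∀ d → d ⊨ exactlyOne (≡-dec _≟ᵇ_ _≟ᵇ_) Aqᶜ quadrants
  exactlyOneQuadrant d = All.head (All.drop⁺ 2 model) d refl

  oneDiagonal : ∀ d → evalK (card ((role h ᶜ) ∩ (role v ᶜ)) =ₗ const 1) d ≡ true
  oneDiagonal d = All.head (All.drop⁺ 3 model) d refl

  tileAxiom : ∀ t → All satisfies (tileAxioms t)
  tileAxiom t =
    All-concatMap⁻ tileAxioms (All.++⁻ˡ (concatMap tileAxioms (allFin n)) (All.drop⁺ 4 model)) (∈-allFin t)

  quadAxiom : ∀ i j → All satisfies (quadAxioms (i , j))
  quadAxiom i j =
    All-concatMap⁻ quadAxioms (All.++⁻ʳ (concatMap tileAxioms (allFin n)) (All.drop⁺ 4 model)) (∈-quadrants (i , j))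

  open UniqueChoice (λ d t → d ⊨ Aᶜ t)
    (λ d → ∃!-∈⁻ ∈-allFin (⊨-exactlyOne⁻ _≟ᶠ_ Aᶜ (allFin n) (exactlyOneTile d)))
    renaming (choice to tile; choice-holds to ⊨-tile; choice-unique to tile-unique)
  open UniqueChoice (λ d q → d ⊨ Aqᶜ q)
    (λ d → ∃!-∈⁻ ∈-quadrants (⊨-exactlyOne⁻ (≡-dec _≟ᵇ_ _≟ᵇ_) Aqᶜ quadrants (exactlyOneQuadrant d)))
    renaming (choice to quadrant; choice-holds to ⊨-quadrant; choice-unique to quadrant-unique)
  open UniqueChoice (λ d e → roleI h d e ≡ true)
    (λ d → ⊨-card-role≡1⇒∃! (proj₁ (h-v-functional d)))
    renaming (choice to east; choice-holds to h-east; choice-unique to h-east-unique)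
  open UniqueChoice (λ d e → roleI v d e ≡ true)
    (λ d → ⊨-card-role≡1⇒∃! (proj₂ (h-v-functional d)))
    renaming (choice to north; choice-holds to v-north; choice-unique to v-north-unique)

  quadrants-agree : ∀ {d q q'} → d ⊨ Aqᶜ q → d ⊨ Aqᶜ q' → q ≡ q'
  quadrants-agree d⊨q d⊨q' = ≡.trans (quadrant-unique d⊨q) (sym (quadrant-unique d⊨q'))

  r-transitive : ∀ {i j d e f} → roleI (r i j) d e ≡ true → roleI (r i j) e f ≡ true →
                 roleI (r i j) d f ≡ true
  r-transitive {i} {j} {d} {e} {f} with quadAxiom i j
  ... | transitive ∷ _ = transitive d e f

  hᵢ⊆rᵢⱼ : ∀ {i j d e} → roleI (hᵢ i) d e ≡ true → roleI (r i j) d e ≡ true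
  hᵢ⊆rᵢⱼ {i} {j} {d} with quadAxiom i j
  ... | _ ∷ hᵢ⊑rᵢⱼ ∷ _ = ⊨-⊆-role (hᵢ⊑rᵢⱼ d refl)

  vⱼ⊆rᵢⱼ : ∀ {i j d e} → roleI (vⱼ j) d e ≡ true → roleI (r i j) d e ≡ true
  vⱼ⊆rᵢⱼ {i} {j} {d} with quadAxiom i j
  ... | _ ∷ _ ∷ vⱼ⊑rᵢⱼ ∷ _ = ⊨-⊆-role (vⱼ⊑rᵢⱼ d refl)

  quadrant-successors : ∀ {i j d} → d ⊨ Aqᶜ (i , j) →
                        evalK (role h ⊆ₛ conc (Aqᶜ (not i , j))) d ≡ true ×
                        evalK (role v ⊆ₛ conc (Aqᶜ (i , not j))) d ≡ true
  quadrant-successors {i} {j} {d} d⊨ij with quadAxiom i j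
  ... | _ ∷ _ ∷ _ ∷ shift ∷ _ =
    ⊨-∧ₖ⁻ (role h ⊆ₛ conc (Aqᶜ (not i , j))) (role v ⊆ₛ conc (Aqᶜ (i , not j))) (shift d d⊨ij)

  quadrant-roles : ∀ {i j d} → d ⊨ Aqᶜ (i , j) →
                   evalK (role h ≐ role (hᵢ i)) d ≡ true × evalK (role v ≐ role (vⱼ j)) d ≡ true
  quadrant-roles {i} {j} {d} d⊨ij with quadAxiom i j
  ... | _ ∷ _ ∷ _ ∷ _ ∷ split ∷ _ = ⊨-∧ₖ⁻ (role h ≐ role (hᵢ i)) (role v ≐ role (vⱼ j)) (split d d⊨ij)

  east-quadrant : ∀ {i j d} → d ⊨ Aqᶜ (i , j) → east d ⊨ Aqᶜ (not i , j)
  east-quadrant {i} {j} {d} d⊨ij = ⊨-⊆-conc (Aqᶜ (not i , j)) (proj₁ (quadrant-successors d⊨ij)) (h-east d)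

  north-quadrant : ∀ {i j d} → d ⊨ Aqᶜ (i , j) → north d ⊨ Aqᶜ (i , not j)
  north-quadrant {i} {j} {d} d⊨ij = ⊨-⊆-conc (Aqᶜ (i , not j)) (proj₂ (quadrant-successors d⊨ij)) (v-north d)

  h⊆hᵢ : ∀ {i j d e} → d ⊨ Aqᶜ (i , j) → roleI h d e ≡ true → roleI (hᵢ i) d e ≡ true
  h⊆hᵢ d⊨ij = ⊨-≐-role (proj₁ (quadrant-roles d⊨ij))

  v⊆vⱼ : ∀ {i j d e} → d ⊨ Aqᶜ (i , j) → roleI v d e ≡ true → roleI (vⱼ j) d e ≡ true
  v⊆vⱼ d⊨ij = ⊨-≐-role (proj₂ (quadrant-roles d⊨ij))

  IsDiagonal : Δ → Δ → Set
  IsDiagonal d e = e ∈ succs d × not (roleI h d e) ∧ not (roleI v d e) ≡ true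

  diagonal-unique : ∀ {d z z′} → IsDiagonal d z → IsDiagonal d z′ → z ≡ z′
  diagonal-unique {d} z-diag z′-diag =
    let _ , _ , only = ⊨-card≡1⇒∃! {s = (role h ᶜ) ∩ (role v ᶜ)} (oneDiagonal d)
    in ≡.trans (sym (only z-diag)) (only z′-diag)

  opposite-not-h : ∀ {i j d z} → d ⊨ Aqᶜ (i , j) → z ⊨ Aqᶜ (not i , not j) → roleI h d z ≡ false
  opposite-not-h {i} {j} d⊨ij z⊨ = ¬-not λ hdz →
    let z⊨′ = subst (_⊨ Aqᶜ (not i , j)) (sym (h-east-unique hdz)) (east-quadrant d⊨ij)
    in not-¬ refl (cong proj₂ (quadrants-agree z⊨′ z⊨))

  opposite-not-v : ∀ {i j d z} → d ⊨ Aqᶜ (i , j) → z ⊨ Aqᶜ (not i , not j) → roleI v d z ≡ false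
  opposite-not-v {i} {j} d⊨ij z⊨ = ¬-not λ vdz →
    let z⊨′ = subst (_⊨ Aqᶜ (i , not j)) (sym (v-north-unique vdz)) (north-quadrant d⊨ij)
    in not-¬ refl (cong proj₁ (quadrants-agree z⊨′ z⊨))

  opposite-diagonal : ∀ {i j d z} → d ⊨ Aqᶜ (i , j) → z ⊨ Aqᶜ (not i , not j) → roleI (r i j) d z ≡ true →
                      IsDiagonal d z
  opposite-diagonal {i} {j} {d} {z} d⊨ij z⊨ rᵢⱼdz =
    succs-complete d z (r i j) rᵢⱼdz ,
    cong₂ (λ x y → not x ∧ not y) (opposite-not-h d⊨ij z⊨) (opposite-not-v d⊨ij z⊨)

  north∘east≡east∘north : ∀ d → north (east d) ≡ east (north d)
  north∘east≡east∘north d =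
    diagonal-unique (opposite-diagonal d⊨ij ne⊨ via-east) (opposite-diagonal d⊨ij en⊨ via-north)
    where
    i j : Bool
    i = proj₁ (quadrant d)
    j = proj₂ (quadrant d)
    d⊨ij : d ⊨ Aqᶜ (i , j)
    d⊨ij = ⊨-quadrant d
    e⊨ : east d ⊨ Aqᶜ (not i , j)
    e⊨ = east-quadrant d⊨ij
    n⊨ : north d ⊨ Aqᶜ (i , not j)
    n⊨ = north-quadrant d⊨ij
    ne⊨ : north (east d) ⊨ Aqᶜ (not i , not j)
    ne⊨ = north-quadrant e⊨
    en⊨ : east (north d) ⊨ Aqᶜ (not i , not j)
    en⊨ = east-quadrant n⊨
    via-east : roleI (r i j) d (north (east d)) ≡ true
    via-east = r-transitive (hᵢ⊆rᵢⱼ (h⊆hᵢ d⊨ij (h-east d))) (vⱼ⊆rᵢⱼ (v⊆vⱼ e⊨ (v-north (east d))))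
    via-north : roleI (r i j) d (east (north d)) ≡ true
    via-north = r-transitive (vⱼ⊆rᵢⱼ (v⊆vⱼ d⊨ij (v-north d))) (hᵢ⊆rᵢⱼ (h⊆hᵢ n⊨ (h-east (north d))))

  tile-successors : ∀ {t d} → d ⊨ Aᶜ t →
                    evalK (role h ⊆ₛ conc (⨆-image H? Aᶜ (allFin n) t)) d ≡ true ×
                    evalK (role v ⊆ₛ conc (⨆-image V? Aᶜ (allFin n) t)) d ≡ true
  tile-successors {t} {d} d⊨t with tileAxiom t
  ... | toEast ∷ toNorth ∷ [] = toEast d d⊨t , toNorth d d⊨t

  tile-east : ∀ d → H (tile d) (tile (east d))
  tile-east d =
    let e⊨image = ⊨-⊆-conc (⨆-image H? Aᶜ (allFin n) (tile d)) (proj₁ (tile-successors (⊨-tile d))) (h-east d)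
        t , Ht , e⊨t = ⊨-⨆-image⁻ H? Aᶜ (allFin n) e⊨image
    in subst (H (tile d)) (tile-unique e⊨t) Ht

  tile-north : ∀ d → V (tile d) (tile (north d))
  tile-north d =
    let n⊨image = ⊨-⊆-conc (⨆-image V? Aᶜ (allFin n) (tile d)) (proj₂ (tile-successors (⊨-tile d))) (v-north d)
        t , Vt , n⊨t = ⊨-⨆-image⁻ V? Aᶜ (allFin n) n⊨image
    in subst (V (tile d)) (tile-unique n⊨t) Vt

  grid : ℕ → ℕ → Δ
  grid x       (suc y) = north (grid x y)
  grid zero    zero    = point
  grid (suc x) zero    = east (grid x zero)

  east-grid : ∀ x y → east (grid x y) ≡ grid (suc x) y
  east-grid x zero    = refl
  east-grid x (suc y) = begin
    east (north (grid x y))  ≡⟨ north∘east≡east∘north (grid x y) ⟨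
    north (east (grid x y))  ≡⟨ cong north (east-grid x y) ⟩
    north (grid (suc x) y)   ∎
    where open ≡-Reasoning

  solution : HasSolution n H V
  solution = (λ x y → tile (grid x y)) , λ x y →
    subst (λ e → H (tile (grid x y)) (tile e)) (east-grid x y) (tile-east (grid x y)) ,
    tile-north (grid x y)

module ModelFromTiling {n : ℕ} {H V : Rel (Fin n) 0ℓ} (H? : Decidable H) (V? : Decidable V)
                       (π : ℕ → ℕ → Fin n)
                       (tiling : ∀ x y → H (π x y) (π (suc x) y) × V (π x y) (π x (suc y))) where
  open Syntax (CName n) RName
  open DerivedConcepts (CName n) RName
  open TilingTBox H? V?

  Point : Set
  Point = ℕ × ℕ

  data Dir : Set where
    east north northeast : Dir

  step : Dir → Point → Point
  step east      (x , y) = suc x , y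
  step north     (x , y) = x , suc y
  step northeast (x , y) = suc x , suc y

  _≟ₚ_ : DecidableEquality Point
  _≟ₚ_ = ≡-dec _≟ℕ_ _≟ℕ_

  -- Opaque so that goals keep the form edge p (step δ p), which edge-step
  -- rewrites; after that every succ-constraint at p evaluates by computation.
  opaque
    edge : Point → Point → Maybe Dir
    edge p q with q ≟ₚ step east p | q ≟ₚ step north p | q ≟ₚ step northeast p
    ... | yes _ | _     | _     = just east
    ... | no _  | yes _ | _     = just north
    ... | no _  | no _  | yes _ = just northeast
    ... | no _  | no _  | no _  = nothing

    edge-step : ∀ δ p → edge p (step δ p) ≡ just δ
    edge-step east p with step east p ≟ₚ step east p
    ... | yes _ = refl
    ... | no ≢  = contradiction refl ≢
    edge-step north (x , y) with (x , suc y) ≟ₚ (suc x , y) | (x , suc y) ≟ₚ (x , suc y)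
    ... | yes eq | _     = contradiction (sym (cong proj₁ eq)) 1+n≢n
    ... | no _   | yes _ = refl
    ... | no _   | no ≢  = contradiction refl ≢
    edge-step northeast (x , y)
      with (suc x , suc y) ≟ₚ (suc x , y) | (suc x , suc y) ≟ₚ (x , suc y) | (suc x , suc y) ≟ₚ (suc x , suc y)
    ... | yes eq | _      | _     = contradiction (cong proj₂ eq) 1+n≢n
    ... | no _   | yes eq | _     = contradiction (cong proj₁ eq) 1+n≢n
    ... | no _   | no _   | yes _ = refl
    ... | no _   | no _   | no ≢  = contradiction refl ≢

    edge-just : ∀ {p q δ} → edge p q ≡ just δ → q ≡ step δ p
    edge-just {p} {q} _ with q ≟ₚ step east p | q ≟ₚ step north p | q ≟ₚ step northeast p
    edge-just refl | yes q≡ | _      | _      = q≡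
    edge-just refl | no _   | yes q≡ | _      = q≡
    edge-just refl | no _   | no _   | yes q≡ = q≡

  parity : ℕ → Bool
  parity zero    = false
  parity (suc x) = not (parity x)

  inColumn inRow : Bool → Point → Bool
  inColumn i (x , _) = does (i ≟ᵇ parity x)
  inRow    j (_ , y) = does (j ≟ᵇ parity y)

  ≟-not-exclusive : ∀ i b → does (i ≟ᵇ b) ≡ true → does (i ≟ᵇ not b) ≡ true → ⊥
  ≟-not-exclusive false false _  ()
  ≟-not-exclusive false true  () _
  ≟-not-exclusive true  false () _
  ≟-not-exclusive true  true  _  ()

  -- hᵢ and vⱼ are h and v restricted to the columns of parity i and the rows
  -- of parity j; r_ij adds the northeast step out of the quadrant (i , j).
  label : RName → Point → Dir → Bool
  label h       _ east      = true
  label v       _ north     = true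
  label (hᵢ i)  p east      = inColumn i p
  label (vⱼ j)  p north     = inRow j p
  label (r i j) p east      = inColumn i p
  label (r i j) p north     = inRow j p
  label (r i j) p northeast = inColumn i p ∧ inRow j p
  label _       _ _         = false

  roleI : RName → Point → Point → Bool
  roleI ρ p q = maybe (label ρ p) false (edge p q)

  roleI-step : ∀ ρ δ p → roleI ρ p (step δ p) ≡ label ρ p δ
  roleI-step ρ δ p = cong (maybe (label ρ p) false) (edge-step δ p)

  roleI-true⇒ : ∀ {ρ p q} → roleI ρ p q ≡ true → ∃ λ δ → q ≡ step δ p × label ρ p δ ≡ true
  roleI-true⇒ {ρ} {p} {q} ρpq with edge p q in pq
  ... | just δ = δ , edge-just pq , ρpq

  conceptI : CName n → Point → Bool
  conceptI (A t)      (x , y) = does (t ≟ᶠ π x y)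
  conceptI (Aq i j)   p       = inColumn i p ∧ inRow j p
  conceptI (extraC _) _       = false

  inQuadrant⇒ : ∀ {x y i j} → conceptI (Aq i j) (x , y) ≡ true → (i , j) ≡ (parity x , parity y)
  inQuadrant⇒ {x} {y} {i} {j} ij =
    cong₂ _,_ (does-true⇒ (i ≟ᵇ parity x) (∧-conicalˡ _ _ ij))
              (does-true⇒ (j ≟ᵇ parity y) (∧-conicalʳ (does (i ≟ᵇ parity x)) _ ij))

  ownQuadrant : ∀ x y → conceptI (Aq (parity x) (parity y)) (x , y) ≡ true
  ownQuadrant x y = cong₂ _∧_ (dec-true (parity x ≟ᵇ parity x) refl) (dec-true (parity y ≟ᵇ parity y) refl)

  succs : Point → List Point
  succs p = step east p ∷ step north p ∷ step northeast p ∷ []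

  step∈succs : ∀ δ p → step δ p ∈ succs p
  step∈succs east      _ = here refl
  step∈succs north     _ = there (here refl)
  step∈succs northeast _ = there (there (here refl))

  gridModel : Interpretation (CName n) RName
  gridModel = record
    { Δ              = Point
    ; point          = 0 , 0
    ; conceptI       = conceptI
    ; roleI          = roleI
    ; succs          = succs
    ; succs-unique   = λ (x , y) →
        ((λ eq → 1+n≢n (cong proj₁ eq)) ∷ (λ eq → 1+n≢n (sym (cong proj₂ eq))) ∷ []) ∷
        ((λ eq → 1+n≢n (sym (cong proj₁ eq))) ∷ []) ∷ [] ∷ []
    ; succs-sound    = λ { p _ (here refl) → h , roleI-step h east p
                         ; p _ (there (here refl)) → v , roleI-step v north p
                         ; (x , y) _ (there (there (here refl))) → r (parity x) (parity y) ,
                             ≡.trans (roleI-step (r _ _) northeast (x , y)) (ownQuadrant x y) }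
    ; succs-complete = λ p q ρ ρpq →
        let δ , q≡ , _ = roleI-true⇒ {ρ} ρpq in subst (_∈ succs p) (sym q≡) (step∈succs δ p)
    }

  open Semantics gridModel
  open Satisfaction gridModel

  exactlyOneTile : ∀ p → p ⊨ exactlyOne _≟ᶠ_ Aᶜ (allFin n)
  exactlyOneTile (x , y) =
    ⊨-exactlyOne⁺ _≟ᶠ_ Aᶜ (allFin n) (∈-allFin (π x y)) (dec-true (π x y ≟ᶠ π x y) refl)
      λ {t} → does-true⇒ (t ≟ᶠ π x y)

  h-v-functional : ∀ p → evalK ((card (role h) =ₗ const 1) ∧ₖ (card (role v) =ₗ const 1)) p ≡ true
  h-v-functional p rewrite edge-step east p | edge-step north p | edge-step northeast p = refl

  exactlyOneQuadrant : ∀ p → p ⊨ exactlyOne (≡-dec _≟ᵇ_ _≟ᵇ_) Aqᶜ quadrants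
  exactlyOneQuadrant (x , y) =
    ⊨-exactlyOne⁺ {x , y} (≡-dec _≟ᵇ_ _≟ᵇ_) Aqᶜ quadrants (∈-quadrants _) (ownQuadrant x y) (inQuadrant⇒ {x} {y})

  oneDiagonal : ∀ p → evalK (card ((role h ᶜ) ∩ (role v ᶜ)) =ₗ const 1) p ≡ true
  oneDiagonal p rewrite edge-step east p | edge-step north p | edge-step northeast p = refl

  tile-h-successors : ∀ t → satisfies (Aᶜ t ⊑ succ (role h ⊆ₛ conc (⨆-image H? Aᶜ (allFin n) t)))
  tile-h-successors t (x , y) t⊨ with refl ← does-true⇒ (t ≟ᶠ π x y) t⊨
    rewrite edge-step east (x , y) | edge-step north (x , y) | edge-step northeast (x , y) =
    cong (_∧ true) (⊨-⨆-image⁺ H? Aᶜ (allFin n) (∈-allFin _) (proj₁ (tiling x y))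
                     (dec-true (π (suc x) y ≟ᶠ π (suc x) y) refl))

  tile-v-successors : ∀ t → satisfies (Aᶜ t ⊑ succ (role v ⊆ₛ conc (⨆-image V? Aᶜ (allFin n) t)))
  tile-v-successors t (x , y) t⊨ with refl ← does-true⇒ (t ≟ᶠ π x y) t⊨
    rewrite edge-step east (x , y) | edge-step north (x , y) | edge-step northeast (x , y) =
    cong (_∧ true) (⊨-⨆-image⁺ V? Aᶜ (allFin n) (∈-allFin _) (proj₂ (tiling x y))
                     (dec-true (π x (suc y) ≟ᶠ π x (suc y)) refl))

  r-transitive : ∀ i j → satisfies (trans (r i j))
  r-transitive i j (x , y) q s pq qs with roleI-true⇒ {r i j} pq
  ... | δ , refl , lpq with roleI-true⇒ {r i j} qs
  ...   | δ′ , refl , lqs = composite δ δ′ lpq lqs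
    where
    column : does (i ≟ᵇ parity x) ≡ true → does (i ≟ᵇ not (parity x)) ≡ true → ⊥
    column = ≟-not-exclusive i (parity x)
    row : does (j ≟ᵇ parity y) ≡ true → does (j ≟ᵇ not (parity y)) ≡ true → ⊥
    row = ≟-not-exclusive j (parity y)
    toNortheast : inColumn i (x , y) ≡ true → inRow j (x , y) ≡ true →
                  roleI (r i j) (x , y) (suc x , suc y) ≡ true
    toNortheast inI inJ = ≡.trans (roleI-step (r i j) northeast (x , y)) (cong₂ _∧_ inI inJ)
    composite : ∀ δ δ′ → label (r i j) (x , y) δ ≡ true → label (r i j) (step δ (x , y)) δ′ ≡ true →
                roleI (r i j) (x , y) (step δ′ (step δ (x , y))) ≡ true
    composite east      east      l l′ = ⊥-elim (column l l′)
    composite east      north     l l′ = toNortheast l l′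
    composite east      northeast l l′ = ⊥-elim (column l (∧-conicalˡ _ _ l′))
    composite north     east      l l′ = toNortheast l′ l
    composite north     north     l l′ = ⊥-elim (row l l′)
    composite north     northeast l l′ = ⊥-elim (row l (∧-conicalʳ (inColumn i (x , suc y)) _ l′))
    composite northeast east      l l′ = ⊥-elim (column (∧-conicalˡ _ _ l) l′)
    composite northeast north     l l′ = ⊥-elim (row (∧-conicalʳ (inColumn i (x , y)) _ l) l′)
    composite northeast northeast l l′ = ⊥-elim (column (∧-conicalˡ _ _ l) (∧-conicalˡ _ _ l′))

  hᵢ⊑rᵢⱼ : ∀ i j → satisfies (roleIncl (hᵢ i) (r i j))
  hᵢ⊑rᵢⱼ i j p _ rewrite edge-step east p | edge-step north p | edge-step northeast p =
    cong (_∧ true) (∨-inverseˡ (inColumn i p))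

  vⱼ⊑rᵢⱼ : ∀ i j → satisfies (roleIncl (vⱼ j) (r i j))
  vⱼ⊑rᵢⱼ i j p _ rewrite edge-step east p | edge-step north p | edge-step northeast p =
    cong (_∧ true) (∨-inverseˡ (inRow j p))

  quadrant-successors : ∀ i j →
    satisfies (Aqᶜ (i , j) ⊑ succ ((role h ⊆ₛ conc (Aqᶜ (not i , j))) ∧ₖ (role v ⊆ₛ conc (Aqᶜ (i , not j)))))
  quadrant-successors i j (x , y) ij with refl ← inQuadrant⇒ {x} {y} {i} {j} ij
    rewrite edge-step east (x , y) | edge-step north (x , y) | edge-step northeast (x , y)
    with parity x | parity y
  ... | false | false = refl
  ... | false | true  = refl
  ... | true  | false = refl
  ... | true  | true  = refl

  quadrant-roles : ∀ i j →
    satisfies (Aqᶜ (i , j) ⊑ succ ((role h ≐ role (hᵢ i)) ∧ₖ (role v ≐ role (vⱼ j))))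
  quadrant-roles i j (x , y) ij with refl ← inQuadrant⇒ {x} {y} {i} {j} ij
    rewrite edge-step east (x , y) | edge-step north (x , y) | edge-step northeast (x , y)
    with parity x | parity y
  ... | false | false = refl
  ... | false | true  = refl
  ... | true  | false = refl
  ... | true  | true  = refl

  isModel : IsModel (𝒯P n H V H? V?)
  isModel =
    (λ p _ → exactlyOneTile p) ∷ (λ p _ → h-v-functional p) ∷
    (λ p _ → exactlyOneQuadrant p) ∷ (λ p _ → oneDiagonal p) ∷
    All.++⁺
      (All-concatMap⁺ {f = tileAxioms} (λ t → tile-h-successors t ∷ tile-v-successors t ∷ []) (allFin n))
      (All-concatMap⁺ {f = quadAxioms}
        (λ (i , j) → r-transitive i j ∷ hᵢ⊑rᵢⱼ i j ∷ vⱼ⊑rᵢⱼ i j ∷ quadrant-successors i j ∷ quadrant-roles i j ∷ [])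
        quadrants)

lemma13 : (n : ℕ) (H V : Rel (Fin n) 0ℓ) (H? : Decidable H) (V? : Decidable V) →
          HasSolution n H V ⇔ Consistent (𝒯P n H V H? V?)
lemma13 n H V H? V? = mk⇔
  (λ (π , tiling) → ModelFromTiling.gridModel H? V? π tiling , ModelFromTiling.isModel H? V? π tiling)
  (λ (I , model) → TilingFromModel.solution H? V? I model)
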